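{- Let $E_1,E_2\subseteq\mathbb{Z}_N$ be nonempty with $|E_2|\le|E_1|$, and let $A\subseteq E_1\times E_2$ with $|A|=\delta|E_1||E_2|$. Then for every $\zeta\in(0,\delta^2)$ either both $\sum_{y\in E_2}(\delta_y-\delta)^2\le\zeta^2|E_2|$ and $\sum_{x\in E_1}(\gamma_x-\delta)^2\le\zeta^2|E_1|$ hold, or there exist $G_1\subseteq E_1$, $G_2\subseteq E_2$ with $|A\cap(G_1\times G_2)|>(\delta+\zeta^3/8)|G_1||G_2|$ and $|G_1|,|G_2|>\zeta^3|E_2|/8$.
   Context: $\delta_y=\frac{1}{|E_1|}|\{x\in E_1:(x,y)\in A\}|$ for $y\in E_2$, and $\gamma_x=\frac{1}{|E_2|}|\{y\in E_2:(x,y)\in A\}|$ for $x\in E_1$. -}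

module Defs where

open import Data.Nat as ℕ using (ℕ; zero; suc)
open import Data.Integer using (+_)
open import Data.Bool using (Bool; true; false; if_then_else_; _∧_)
open import Data.Fin using (Fin; zero; suc)
open import Data.Fin.Subset using (Subset; ∣_∣)
open import Data.Vec using (lookup)
open import Data.Rational using (ℚ; _/_; 0ℚ; _+_; _-_; _*_)

toℚ : ℕ → ℚ
toℚ n = + n / 1

-- m / n as a rational, with the (never used) convention m / 0 = 0
_/ℕ_ : ℕ → ℕ → ℚ
m /ℕ zero = 0ℚ
m /ℕ suc k = + m / suc k

sumℚ : ∀ {n} → (Fin n → ℚ) → ℚ
sumℚ {zero} f = 0ℚ
sumℚ {suc n} f = f zero + sumℚ (λ i → f (suc i))

count : ∀ {n} → (Fin n → Bool) → ℕ
count {zero} P = 0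
count {suc n} P = (if P zero then 1 else 0) ℕ.+ count (λ i → P (suc i))

sumOver : ∀ {n} → Subset n → (Fin n → ℚ) → ℚ
sumOver E f = sumℚ (λ i → if lookup E i then f i else 0ℚ)

-- a relation A ⊆ Z_N × Z_N is given by its indicator function
Rel : ℕ → Set
Rel N = Fin N → Fin N → Bool

sumℕ : ∀ {n} → (Fin n → ℕ) → ℕ
sumℕ {zero} f = 0
sumℕ {suc n} f = f zero ℕ.+ sumℕ (λ i → f (suc i))

cardIn : ∀ {N} → Rel N → Subset N → Subset N → ℕ
cardIn A G₁ G₂ = sumℕ (λ x → count (λ y → lookup G₁ x ∧ lookup G₂ y ∧ A x y))

cardRel : ∀ {N} → Rel N → ℕ
cardRel A = sumℕ (λ x → count (λ y → A x y))

density : ∀ {N} → Subset N → Subset N → Rel N → ℚ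
density E₁ E₂ A = cardRel A /ℕ (∣ E₁ ∣ ℕ.* ∣ E₂ ∣)

δ_ : ∀ {N} → Subset N → Rel N → Fin N → ℚ
δ_ E₁ A y = count (λ x → lookup E₁ x ∧ A x y) /ℕ ∣ E₁ ∣

γ_ : ∀ {N} → Subset N → Rel N → Fin N → ℚ
γ_ E₂ A x = count (λ y → lookup E₂ y ∧ A x y) /ℕ ∣ E₂ ∣

-- Write γ_x = δ + g_x. Since A ⊆ E₁ × E₂, the deviations g_x sum to 0 over E₁ and lie in [-1, 1],
-- so the pointwise bound g² + g ≤ 2 max(g, 0) gives Σ_{E₁} g² ≤ 2S, where S is the sum of g over the
-- rows G where g > 0. If the row variance exceeds ζ²|E₁|, then S > ζ²|E₁|/2; as S ≤ |G| ≤ |E₁| and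
-- ζ < δ² ≤ 1, this gives |G| > ζ²|E₁|/2 and S > (ζ³/8)|G|. Since |A ∩ (G × E₂)| = (δ|G| + S)|E₂|,
-- the pair (G, E₂) is the required density increment (the size bounds relative to |E₂| use
-- |E₂| ≤ |E₁|). The column case is the row case for the transposed relation.

{-# OPTIONS --safe #-}
module Submission where

open import Defs
open import Data.Nat as ℕ using (ℕ; zero; suc)
import Data.Nat.Properties as ℕP
open import Data.Nat.Coprimality using (1-coprimeTo)
import Data.Nat.Coprimality as Coprime
open import Data.Integer as ℤ using (+_)
import Data.Integer.Properties as ℤP
open import Data.Bool using (Bool; true; false; T; if_then_else_; _∧_)
open import Data.Unit using (tt)
open import Data.Product using (_×_; _,_; proj₁; proj₂; ∃; ∃₂)
open import Data.Sum using (_⊎_; inj₁; inj₂)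
open import Data.Fin using (Fin; zero; suc)
open import Data.Fin.Subset using (Subset; _⊆_; _∈_; _∩_; ∣_∣; Nonempty)
open import Data.Fin.Subset.Properties using (p∩q⊆p; p⊆q⇒∣p∣≤∣q∣; x∈p⇒∣p-x∣<∣p∣)
open import Data.Vec using ([]; _∷_; lookup; tabulate)
open import Data.Vec.Properties using (lookup-zipWith; lookup∘tabulate; lookup⇒[]=; []=⇒lookup)
open import Data.Rational
  using (ℚ; mkℚ; _/_; 0ℚ; 1ℚ; _+_; _-_; _*_; -_; _≤_; _<_; *≤*; toℚᵘ; NonNegative; positive; nonNegative; nonPositive)
open import Data.Rational.Properties
import Data.Rational.Unnormalised as ℚᵘ
import Data.Rational.Unnormalised.Properties as ℚᵘP
open import Data.Rational.Solver using (module +-*-Solver)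
open import Algebra.Bundles using (Ring; CommutativeMonoid)
import Algebra.Properties.CommutativeSemigroup as CommutativeSemigroupProperties
open import Data.Bool.Properties using (∧-commutativeMonoid)
import Algebra.Properties.CommutativeMonoid.Sum as CommutativeMonoidSum
import Algebra.Properties.Semiring.Sum as SemiringSum
open import Function using (_∘_)
open import Relation.Binary.PropositionalEquality
open import Relation.Nullary using (¬_; Dec; yes; no; does)

module ℕΣ = CommutativeMonoidSum ℕP.+-0-commutativeMonoid
module ℚΣ = SemiringSum (Ring.semiring +-*-ring)

∧-swap : ∀ a b c → a ∧ (b ∧ c) ≡ b ∧ (a ∧ c)
∧-swap = CommutativeSemigroupProperties.x∙yz≈y∙xz (CommutativeMonoid.commutativeSemigroup ∧-commutativeMonoid)

*-xy∙z≈xz∙y : ∀ x y z → x * y * z ≡ x * z * y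
*-xy∙z≈xz∙y = CommutativeSemigroupProperties.xy∙z≈xz∙y (CommutativeMonoid.commutativeSemigroup *-1-commutativeMonoid)

∧-absorbs-implied : ∀ a b → (T b → a ≡ true) → a ∧ b ≡ b
∧-absorbs-implied true  b     _   = refl
∧-absorbs-implied false false _   = refl
∧-absorbs-implied false true  b⇒a = b⇒a tt

toℚ≡mkℚ : ∀ n → toℚ n ≡ mkℚ (+ n) 0 (Coprime.sym (1-coprimeTo n))
toℚ≡mkℚ n = normalize-coprime (Coprime.sym (1-coprimeTo n))

toℚ-+ : ∀ m n → toℚ (m ℕ.+ n) ≡ toℚ m + toℚ n
toℚ-+ m n rewrite toℚ≡mkℚ m | toℚ≡mkℚ n =
  sym (/-cong (cong₂ ℤ._+_ (ℤP.*-identityʳ (+ m)) (ℤP.*-identityʳ (+ n))) refl)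

toℚ-* : ∀ m n → toℚ (m ℕ.* n) ≡ toℚ m * toℚ n
toℚ-* m n rewrite toℚ≡mkℚ m | toℚ≡mkℚ n = /-cong (ℤP.pos-* m n) refl

toℚ-mono-≤ : ∀ {m n} → m ℕ.≤ n → toℚ m ≤ toℚ n
toℚ-mono-≤ {m} {n} m≤n rewrite toℚ≡mkℚ m | toℚ≡mkℚ n =
  *≤* (subst₂ ℤ._≤_ (sym (ℤP.*-identityʳ (+ m))) (sym (ℤP.*-identityʳ (+ n))) (ℤ.+≤+ m≤n))

toℚ-nonNeg : ∀ n → 0ℚ ≤ toℚ n
toℚ-nonNeg n = toℚ-mono-≤ (ℕ.z≤n {n})

toℚ-pos : ∀ {n} → 0 ℕ.< n → 0ℚ < toℚ n
toℚ-pos {suc n} _ = positive⁻¹ (toℚ (suc n)) {{normalize-pos (suc n) 1}}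

m/ℕn*n≡m : ∀ m {n} → 0 ℕ.< n → (m /ℕ n) * toℚ n ≡ toℚ m
m/ℕn*n≡m m {suc k} _ = toℚᵘ-injective (begin
  toℚᵘ ((+ m / suc k) * toℚ (suc k))                      ≈⟨ toℚᵘ-homo-* (+ m / suc k) (toℚ (suc k)) ⟩
  toℚᵘ (+ m / suc k) ℚᵘ.* toℚᵘ (toℚ (suc k))              ≈⟨ ℚᵘP.*-cong (toℚᵘ-fromℚᵘ (ℚᵘ.mkℚᵘ (+ m) k))
                                                                       (toℚᵘ-fromℚᵘ (ℚᵘ.mkℚᵘ (+ suc k) 0)) ⟩
  ℚᵘ.mkℚᵘ (+ m) k ℚᵘ.* ℚᵘ.mkℚᵘ (+ suc k) 0                ≈⟨ ℚᵘ.*≡* (ℤP.*-assoc (+ m) (+ suc k) (+ 1)) ⟩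
  ℚᵘ.mkℚᵘ (+ m) 0                                         ≈⟨ ℚᵘP.≃-sym (toℚᵘ-fromℚᵘ (ℚᵘ.mkℚᵘ (+ m) 0)) ⟩
  toℚᵘ (toℚ m)                                            ∎)
  where open ℚᵘP.≃-Reasoning

/ℕ-nonNeg : ∀ m n → 0ℚ ≤ m /ℕ n
/ℕ-nonNeg m zero    = ≤-refl
/ℕ-nonNeg m (suc k) = nonNegative⁻¹ (+ m / suc k) {{normalize-nonNeg m (suc k)}}

*-cancelʳ-≡-pos : ∀ {p q} r → 0ℚ < r → p * r ≡ q * r → p ≡ q
*-cancelʳ-≡-pos r 0<r pr≡qr = ≤-antisym
  (*-cancelʳ-≤-pos r {{positive 0<r}} (≤-reflexive pr≡qr))
  (*-cancelʳ-≤-pos r {{positive 0<r}} (≤-reflexive (sym pr≡qr)))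

m*n>0 : ∀ {m n} → 0 ℕ.< m → 0 ℕ.< n → 0 ℕ.< m ℕ.* n
m*n>0 {suc m} {suc n} _ _ = ℕP.0<1+n

x*x≤1 : ∀ {x} → 0ℚ ≤ x → x ≤ 1ℚ → x * x ≤ 1ℚ
x*x≤1 {x} 0≤x x≤1 = begin
  x * x     ≤⟨ *-monoˡ-≤-nonNeg x {{nonNegative 0≤x}} x≤1 ⟩
  x * 1ℚ    ≡⟨ *-identityʳ x ⟩
  x         ≤⟨ x≤1 ⟩
  1ℚ        ∎
  where open ≤-Reasoning

p<q+q⇒p/2<q : ∀ {p q} → p < q + q → p * (+ 1 / 2) < q
p<q+q⇒p/2<q {p} {q} p<2q = begin-strict
  p * (+ 1 / 2)          <⟨ *-monoˡ-<-pos (+ 1 / 2) p<2q ⟩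
  (q + q) * (+ 1 / 2)    ≡⟨ solve 1 (λ q → (q :+ q) :* con (+ 1 / 2) := q) refl q ⟩
  q                      ∎
  where
  open ≤-Reasoning
  open +-*-Solver

cube/8≤square/2 : ∀ {ζ X Y} → 0ℚ ≤ ζ → ζ ≤ 1ℚ → 0ℚ ≤ X → X ≤ Y →
                  ζ * ζ * ζ * X * (+ 1 / 8) ≤ ζ * ζ * Y * (+ 1 / 2)
cube/8≤square/2 {ζ} {X} {Y} 0≤ζ ζ≤1 0≤X X≤Y = begin
  ζ * ζ * ζ * X * (+ 1 / 8)      ≡⟨ solve 2 (λ ζ X → ζ :* ζ :* ζ :* X :* con (+ 1 / 8)
                                                   := ζ :* ζ :* X :* (ζ :* con (+ 1 / 8))) refl ζ X ⟩
  ζ * ζ * X * (ζ * (+ 1 / 8))    ≤⟨ *-monoˡ-≤-nonNeg (ζ * ζ * X) {{0≤ζζX}} ζ/8≤1/2 ⟩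
  ζ * ζ * X * (+ 1 / 2)          ≤⟨ *-monoʳ-≤-nonNeg (+ 1 / 2) (*-monoˡ-≤-nonNeg (ζ * ζ) {{0≤ζζ}} X≤Y) ⟩
  ζ * ζ * Y * (+ 1 / 2)          ∎
  where
  open ≤-Reasoning
  open +-*-Solver
  0≤ζζ : NonNegative (ζ * ζ)
  0≤ζζ = nonNeg*nonNeg⇒nonNeg ζ {{nonNegative 0≤ζ}} ζ {{nonNegative 0≤ζ}}
  0≤ζζX : NonNegative (ζ * ζ * X)
  0≤ζζX = nonNeg*nonNeg⇒nonNeg (ζ * ζ) {{0≤ζζ}} X {{nonNegative 0≤X}}
  ζ/8≤1/2 : ζ * (+ 1 / 8) ≤ + 1 / 2
  ζ/8≤1/2 = ≤-trans (*-monoʳ-≤-nonNeg (+ 1 / 8) ζ≤1) (≤ᵇ⇒≤ tt)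

cube/8< : ∀ {ζ X Y} → 0ℚ ≤ ζ → ζ ≤ 1ℚ → 0ℚ < X → X ≤ Y → ζ * ζ * ζ * X * (+ 1 / 8) < Y
cube/8< {ζ} {X} {Y} 0≤ζ ζ≤1 0<X X≤Y = begin-strict
  ζ * ζ * ζ * X * (+ 1 / 8)    ≤⟨ cube/8≤square/2 0≤ζ ζ≤1 (<⇒≤ 0<X) ≤-refl ⟩
  ζ * ζ * X * (+ 1 / 2)        ≤⟨ *-monoʳ-≤-nonNeg (+ 1 / 2)
                                    (*-monoʳ-≤-nonNeg X {{nonNegative (<⇒≤ 0<X)}} (x*x≤1 0≤ζ ζ≤1)) ⟩
  1ℚ * X * (+ 1 / 2)           ≡⟨ cong (_* (+ 1 / 2)) (*-identityˡ X) ⟩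
  X * (+ 1 / 2)                <⟨ p<q+q⇒p/2<q X<X+X ⟩
  X                            ≤⟨ X≤Y ⟩
  Y                            ∎
  where
  open ≤-Reasoning
  X<X+X : X < X + X
  X<X+X = subst (_< X + X) (+-identityʳ X) (+-monoʳ-< X 0<X)

sumℚ≡sum : ∀ {n} (f : Fin n → ℚ) → sumℚ f ≡ ℚΣ.sum f
sumℚ≡sum {zero}  f = refl
sumℚ≡sum {suc n} f = cong (λ s → f zero + s) (sumℚ≡sum (f ∘ suc))

sumℚ-cong : ∀ {n} {f h : Fin n → ℚ} → (∀ i → f i ≡ h i) → sumℚ f ≡ sumℚ h
sumℚ-cong {f = f} {h} f≗h = trans (sumℚ≡sum f) (trans (ℚΣ.sum-cong-≗ f≗h) (sym (sumℚ≡sum h)))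

sumℚ-+ : ∀ {n} (f h : Fin n → ℚ) → sumℚ (λ i → f i + h i) ≡ sumℚ f + sumℚ h
sumℚ-+ f h = begin
  sumℚ (λ i → f i + h i)      ≡⟨ sumℚ≡sum (λ i → f i + h i) ⟩
  ℚΣ.sum (λ i → f i + h i)    ≡⟨ ℚΣ.∑-distrib-+ f h ⟩
  ℚΣ.sum f + ℚΣ.sum h         ≡⟨ sym (cong₂ _+_ (sumℚ≡sum f) (sumℚ≡sum h)) ⟩
  sumℚ f + sumℚ h             ∎
  where open ≡-Reasoning

sumℚ-*ʳ : ∀ {n} (f : Fin n → ℚ) c → sumℚ (λ i → f i * c) ≡ sumℚ f * c
sumℚ-*ʳ f c = begin
  sumℚ (λ i → f i * c)     ≡⟨ sumℚ≡sum (λ i → f i * c) ⟩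
  ℚΣ.sum (λ i → f i * c)   ≡⟨ sym (ℚΣ.*-distribʳ-sum c f) ⟩
  ℚΣ.sum f * c             ≡⟨ cong (_* c) (sym (sumℚ≡sum f)) ⟩
  sumℚ f * c               ∎
  where open ≡-Reasoning

sumℚ-mono-≤ : ∀ {n} {f h : Fin n → ℚ} → (∀ i → f i ≤ h i) → sumℚ f ≤ sumℚ h
sumℚ-mono-≤ {zero}  f≤h = ≤-refl
sumℚ-mono-≤ {suc n} f≤h = +-mono-≤ (f≤h zero) (sumℚ-mono-≤ (f≤h ∘ suc))

module _ {N : ℕ} (E : Subset N) where

  private
    restrict : (Fin N → ℚ) → Fin N → ℚ
    restrict f i = if lookup E i then f i else 0ℚ

  sumOver-cong : {f h : Fin N → ℚ} → (∀ i → i ∈ E → f i ≡ h i) → sumOver E f ≡ sumOver E h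
  sumOver-cong {f} {h} f≡h = sumℚ-cong pointwise
    where
    pointwise : ∀ i → (if lookup E i then f i else 0ℚ) ≡ (if lookup E i then h i else 0ℚ)
    pointwise i with lookup E i in eq
    ... | true  = f≡h i (lookup⇒[]= i E eq)
    ... | false = refl

  sumOver-+ : (f h : Fin N → ℚ) → sumOver E (λ i → f i + h i) ≡ sumOver E f + sumOver E h
  sumOver-+ f h = trans (sumℚ-cong pointwise) (sumℚ-+ (restrict f) (restrict h))
    where
    pointwise : ∀ i → (if lookup E i then f i + h i else 0ℚ)
                    ≡ (if lookup E i then f i else 0ℚ) + (if lookup E i then h i else 0ℚ)
    pointwise i with lookup E i
    ... | true  = refl
    ... | false = sym (+-identityʳ 0ℚ)

  sumOver-*ʳ : (f : Fin N → ℚ) (c : ℚ) → sumOver E (λ i → f i * c) ≡ sumOver E f * c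
  sumOver-*ʳ f c = trans (sumℚ-cong pointwise) (sumℚ-*ʳ (restrict f) c)
    where
    pointwise : ∀ i → (if lookup E i then f i * c else 0ℚ) ≡ (if lookup E i then f i else 0ℚ) * c
    pointwise i with lookup E i
    ... | true  = refl
    ... | false = sym (*-zeroˡ c)

  sumOver-mono-≤ : {f h : Fin N → ℚ} → (∀ i → i ∈ E → f i ≤ h i) → sumOver E f ≤ sumOver E h
  sumOver-mono-≤ {f} {h} f≤h = sumℚ-mono-≤ pointwise
    where
    pointwise : ∀ i → (if lookup E i then f i else 0ℚ) ≤ (if lookup E i then h i else 0ℚ)
    pointwise i with lookup E i in eq
    ... | true  = f≤h i (lookup⇒[]= i E eq)
    ... | false = ≤-refl

  sumOver-∩-tabulate : (P : Fin N → Bool) (f : Fin N → ℚ) →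
                       sumOver (E ∩ tabulate P) f ≡ sumOver E (λ i → if P i then f i else 0ℚ)
  sumOver-∩-tabulate P f = sumℚ-cong pointwise
    where
    pointwise : ∀ i → (if lookup (E ∩ tabulate P) i then f i else 0ℚ)
                    ≡ (if lookup E i then (if P i then f i else 0ℚ) else 0ℚ)
    pointwise i rewrite lookup-zipWith _∧_ i E (tabulate P) | lookup∘tabulate P i with lookup E i
    ... | true  = refl
    ... | false = refl

toℚ∣E∣≡sumOver1 : ∀ {N} (E : Subset N) → toℚ ∣ E ∣ ≡ sumOver E (λ _ → 1ℚ)
toℚ∣E∣≡sumOver1 []          = refl
toℚ∣E∣≡sumOver1 (true ∷ E)  = trans (toℚ-+ 1 ∣ E ∣) (cong (λ s → 1ℚ + s) (toℚ∣E∣≡sumOver1 E))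
toℚ∣E∣≡sumOver1 (false ∷ E) = trans (toℚ∣E∣≡sumOver1 E) (sym (+-identityˡ _))

sumOver-const : ∀ {N} (E : Subset N) (c : ℚ) → sumOver E (λ _ → c) ≡ c * toℚ ∣ E ∣
sumOver-const E c = begin
  sumOver E (λ _ → c)         ≡⟨ sumOver-cong E (λ _ _ → sym (*-identityˡ c)) ⟩
  sumOver E (λ _ → 1ℚ * c)    ≡⟨ sumOver-*ʳ E (λ _ → 1ℚ) c ⟩
  sumOver E (λ _ → 1ℚ) * c    ≡⟨ cong (_* c) (sym (toℚ∣E∣≡sumOver1 E)) ⟩
  toℚ ∣ E ∣ * c               ≡⟨ *-comm (toℚ ∣ E ∣) c ⟩
  c * toℚ ∣ E ∣               ∎
  where open ≡-Reasoning

count-false : ∀ {n} → count {n} (λ _ → false) ≡ 0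
count-false {zero}  = refl
count-false {suc n} = count-false {n}

count-cong : ∀ {n} {P Q : Fin n → Bool} → (∀ i → P i ≡ Q i) → count P ≡ count Q
count-cong {zero}  P≗Q = refl
count-cong {suc n} P≗Q = cong₂ ℕ._+_ (cong (λ b → if b then 1 else 0) (P≗Q zero)) (count-cong (P≗Q ∘ suc))

count-∩≤∣∣ : ∀ {n} (E : Subset n) (P : Fin n → Bool) → count (λ i → lookup E i ∧ P i) ℕ.≤ ∣ E ∣
count-∩≤∣∣ []          P = ℕ.z≤n
count-∩≤∣∣ (false ∷ E) P = count-∩≤∣∣ E (P ∘ suc)
count-∩≤∣∣ (true ∷ E)  P with P zero
... | true  = ℕ.s≤s (count-∩≤∣∣ E (P ∘ suc))
... | false = ℕP.m≤n⇒m≤1+n (count-∩≤∣∣ E (P ∘ suc))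

count≡sum : ∀ {n} (P : Fin n → Bool) → count P ≡ ℕΣ.sum (λ i → if P i then 1 else 0)
count≡sum {zero}  P = refl
count≡sum {suc n} P = cong ((if P zero then 1 else 0) ℕ.+_) (count≡sum (P ∘ suc))

sumℕ≡sum : ∀ {n} (f : Fin n → ℕ) → sumℕ f ≡ ℕΣ.sum f
sumℕ≡sum {zero}  f = refl
sumℕ≡sum {suc n} f = cong (f zero ℕ.+_) (sumℕ≡sum (f ∘ suc))

sumℕ-cong : ∀ {n} {f h : Fin n → ℕ} → (∀ i → f i ≡ h i) → sumℕ f ≡ sumℕ h
sumℕ-cong {f = f} {h} f≗h = trans (sumℕ≡sum f) (trans (ℕΣ.sum-cong-≗ f≗h) (sym (sumℕ≡sum h)))

sumℕ-count-comm : ∀ {m n} (P : Fin m → Fin n → Bool) →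
                  sumℕ (λ x → count (P x)) ≡ sumℕ (λ y → count (λ x → P x y))
sumℕ-count-comm P = begin
  sumℕ (λ x → count (P x))                                ≡⟨ sumℕ≡sum (λ x → count (P x)) ⟩
  ℕΣ.sum (λ x → count (P x))                              ≡⟨ ℕΣ.sum-cong-≗ (λ x → count≡sum (P x)) ⟩
  ℕΣ.sum (λ x → ℕΣ.sum (λ y → if P x y then 1 else 0))    ≡⟨ ℕΣ.∑-comm (λ x y → if P x y then 1 else 0) ⟩
  ℕΣ.sum (λ y → ℕΣ.sum (λ x → if P x y then 1 else 0))    ≡⟨ ℕΣ.sum-cong-≗ (λ y → count≡sum (λ x → P x y)) ⟨
  ℕΣ.sum (λ y → count (λ x → P x y))                      ≡⟨ sumℕ≡sum (λ y → count (λ x → P x y)) ⟨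
  sumℕ (λ y → count (λ x → P x y))                        ∎
  where open ≡-Reasoning

toℚ-sumℕ : ∀ {n} (f : Fin n → ℕ) → toℚ (sumℕ f) ≡ sumℚ (toℚ ∘ f)
toℚ-sumℕ {zero}  f = refl
toℚ-sumℕ {suc n} f = trans (toℚ-+ (f zero) _) (cong (λ s → toℚ (f zero) + s) (toℚ-sumℕ (f ∘ suc)))

nonempty⇒∣∣>0 : ∀ {N} {E : Subset N} → Nonempty E → 0 ℕ.< ∣ E ∣
nonempty⇒∣∣>0 (x , x∈E) = ℕP.≤-<-trans ℕ.z≤n (x∈p⇒∣p-x∣<∣p∣ x∈E)

positiveIn : ∀ {N} → Subset N → (Fin N → ℚ) → Subset N
positiveIn E g = E ∩ tabulate (λ i → does (0ℚ <? g i))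

x*x+x≤2x⁺ : ∀ x → - 1ℚ ≤ x → x ≤ 1ℚ → (0<x? : Dec (0ℚ < x)) →
            x * x + x ≤ (if does 0<x? then x + x else 0ℚ)
x*x+x≤2x⁺ x -1≤x x≤1 (yes 0<x) = +-monoˡ-≤ x (begin
  x * x     ≤⟨ *-monoˡ-≤-nonNeg x {{nonNegative (<⇒≤ 0<x)}} x≤1 ⟩
  x * 1ℚ    ≡⟨ *-identityʳ x ⟩
  x         ∎)
  where open ≤-Reasoning
x*x+x≤2x⁺ x -1≤x x≤1 (no 0≮x) = begin
  x * x + x       ≤⟨ +-monoˡ-≤ x (*-monoˡ-≤-nonPos x {{nonPositive (≮⇒≥ 0≮x)}} -1≤x) ⟩
  x * - 1ℚ + x    ≡⟨ solve 1 (λ x → x :* (:- con 1ℚ) :+ x := con 0ℚ) refl x ⟩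
  0ℚ              ∎
  where
  open ≤-Reasoning
  open +-*-Solver

module _ {N : ℕ} (E : Subset N) (g : Fin N → ℚ)
         (g-bounds : ∀ i → i ∈ E → - 1ℚ ≤ g i × g i ≤ 1ℚ) where

  sumOver-square≤2sumOver-positive : sumOver E g ≡ 0ℚ →
    sumOver E (λ i → g i * g i) ≤ sumOver (positiveIn E g) g + sumOver (positiveIn E g) g
  sumOver-square≤2sumOver-positive Σg≡0 = begin
    sumOver E (λ i → g i * g i)                             ≡⟨ +-identityʳ _ ⟨
    sumOver E (λ i → g i * g i) + 0ℚ                        ≡⟨ cong (λ s → sumOver E (λ i → g i * g i) + s) Σg≡0 ⟨
    sumOver E (λ i → g i * g i) + sumOver E g               ≡⟨ sumOver-+ E (λ i → g i * g i) g ⟨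
    sumOver E (λ i → g i * g i + g i)                       ≤⟨ sumOver-mono-≤ E pointwise ⟩
    sumOver E (λ i → if positive? i then g i + g i else 0ℚ) ≡⟨ sumOver-∩-tabulate E positive? (λ i → g i + g i) ⟨
    sumOver G (λ i → g i + g i)                             ≡⟨ sumOver-+ G g g ⟩
    sumOver G g + sumOver G g                               ∎
    where
    open ≤-Reasoning
    G : Subset N
    G = positiveIn E g
    positive? : Fin N → Bool
    positive? i = does (0ℚ <? g i)
    pointwise : ∀ i → i ∈ E → g i * g i + g i ≤ (if positive? i then g i + g i else 0ℚ)
    pointwise i i∈E = x*x+x≤2x⁺ (g i) (proj₁ (g-bounds i i∈E)) (proj₂ (g-bounds i i∈E)) (0ℚ <? g i)

  sumOver-positive≤∣positive∣ : sumOver (positiveIn E g) g ≤ toℚ ∣ positiveIn E g ∣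
  sumOver-positive≤∣positive∣ = begin
    sumOver G g             ≤⟨ sumOver-mono-≤ G (λ i i∈G → proj₂ (g-bounds i (p∩q⊆p E _ i∈G))) ⟩
    sumOver G (λ _ → 1ℚ)    ≡⟨ toℚ∣E∣≡sumOver1 G ⟨
    toℚ ∣ G ∣               ∎
    where
    open ≤-Reasoning
    G : Subset N
    G = positiveIn E g

_ᵀ : ∀ {N} → Rel N → Rel N
(A ᵀ) y x = A x y

cardIn-ᵀ : ∀ {N} (A : Rel N) (G₁ G₂ : Subset N) → cardIn (A ᵀ) G₂ G₁ ≡ cardIn A G₁ G₂
cardIn-ᵀ A G₁ G₂ = begin
  cardIn (A ᵀ) G₂ G₁
    ≡⟨ sumℕ-count-comm (λ y x → lookup G₂ y ∧ lookup G₁ x ∧ A x y) ⟩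
  sumℕ (λ x → count (λ y → lookup G₂ y ∧ lookup G₁ x ∧ A x y))
    ≡⟨ sumℕ-cong (λ x → count-cong (λ y → ∧-swap (lookup G₂ y) (lookup G₁ x) (A x y))) ⟩
  cardIn A G₁ G₂
    ∎
  where open ≡-Reasoning

density-ᵀ : ∀ {N} (E₁ E₂ : Subset N) (A : Rel N) → density E₂ E₁ (A ᵀ) ≡ density E₁ E₂ A
density-ᵀ E₁ E₂ A = cong₂ _/ℕ_ (sumℕ-count-comm (λ y x → A x y)) (ℕP.*-comm ∣ E₂ ∣ ∣ E₁ ∣)

density-nonNeg : ∀ {N} (E₁ E₂ : Subset N) (A : Rel N) → 0ℚ ≤ density E₁ E₂ A
density-nonNeg E₁ E₂ A = /ℕ-nonNeg (cardRel A) (∣ E₁ ∣ ℕ.* ∣ E₂ ∣)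

module _ {N : ℕ} {E₁ E₂ : Subset N} {A : Rel N}
         (A⊆E₁×E₂ : ∀ x y → T (A x y) → x ∈ E₁ × y ∈ E₂)
         (ne₁ : Nonempty E₁) (ne₂ : Nonempty E₂) where

  private
    δA : ℚ
    δA = density E₁ E₂ A
    γA : Fin N → ℚ
    γA = γ_ E₂ A
    rowCount : Fin N → ℕ
    rowCount x = count (λ y → lookup E₂ y ∧ A x y)
    0<∣E₁∣ : 0 ℕ.< ∣ E₁ ∣
    0<∣E₁∣ = nonempty⇒∣∣>0 ne₁
    0<∣E₂∣ : 0 ℕ.< ∣ E₂ ∣
    0<∣E₂∣ = nonempty⇒∣∣>0 ne₂

  γ*∣E₂∣≡rowCount : ∀ x → γA x * toℚ ∣ E₂ ∣ ≡ toℚ (rowCount x)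
  γ*∣E₂∣≡rowCount x = m/ℕn*n≡m (rowCount x) 0<∣E₂∣

  γ≤1 : ∀ x → γA x ≤ 1ℚ
  γ≤1 x = *-cancelʳ-≤-pos (toℚ ∣ E₂ ∣) {{positive (toℚ-pos 0<∣E₂∣)}} (begin
    γA x * toℚ ∣ E₂ ∣    ≡⟨ γ*∣E₂∣≡rowCount x ⟩
    toℚ (rowCount x)    ≤⟨ toℚ-mono-≤ (count-∩≤∣∣ E₂ (A x)) ⟩
    toℚ ∣ E₂ ∣          ≡⟨ *-identityˡ _ ⟨
    1ℚ * toℚ ∣ E₂ ∣     ∎)
    where open ≤-Reasoning

  cardIn≡sumOverγ*∣E₂∣ : ∀ G → toℚ (cardIn A G E₂) ≡ sumOver G γA * toℚ ∣ E₂ ∣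
  cardIn≡sumOverγ*∣E₂∣ G = begin
    toℚ (cardIn A G E₂)
      ≡⟨ toℚ-sumℕ (λ x → count (λ y → lookup G x ∧ lookup E₂ y ∧ A x y)) ⟩
    sumℚ (λ x → toℚ (count (λ y → lookup G x ∧ lookup E₂ y ∧ A x y)))
      ≡⟨ sumℚ-cong rowsOfG ⟩
    sumOver G (λ x → toℚ (rowCount x))        ≡⟨ sumOver-cong G (λ x _ → γ*∣E₂∣≡rowCount x) ⟨
    sumOver G (λ x → γA x * toℚ ∣ E₂ ∣)        ≡⟨ sumOver-*ʳ G γA (toℚ ∣ E₂ ∣) ⟩
    sumOver G γA * toℚ ∣ E₂ ∣                  ∎
    where
    open ≡-Reasoning
    rowsOfG : ∀ x → toℚ (count (λ y → lookup G x ∧ lookup E₂ y ∧ A x y))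
                  ≡ (if lookup G x then toℚ (rowCount x) else 0ℚ)
    rowsOfG x with lookup G x
    ... | true  = refl
    ... | false = cong toℚ (count-false {N})

  cardRel≡cardIn : cardRel A ≡ cardIn A E₁ E₂
  cardRel≡cardIn = sumℕ-cong (λ x → count-cong (λ y → sym (begin
    lookup E₁ x ∧ lookup E₂ y ∧ A x y
      ≡⟨ cong (lookup E₁ x ∧_) (∧-absorbs-implied _ _ (λ t → []=⇒lookup (proj₂ (A⊆E₁×E₂ x y t)))) ⟩
    lookup E₁ x ∧ A x y
      ≡⟨ ∧-absorbs-implied _ _ (λ t → []=⇒lookup (proj₁ (A⊆E₁×E₂ x y t))) ⟩
    A x y
      ∎)))
    where open ≡-Reasoning

  sumOverγ≡density*∣E₁∣ : sumOver E₁ γA ≡ δA * toℚ ∣ E₁ ∣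
  sumOverγ≡density*∣E₁∣ = *-cancelʳ-≡-pos (toℚ ∣ E₂ ∣) (toℚ-pos 0<∣E₂∣) (begin
    sumOver E₁ γA * toℚ ∣ E₂ ∣                  ≡⟨ cardIn≡sumOverγ*∣E₂∣ E₁ ⟨
    toℚ (cardIn A E₁ E₂)                       ≡⟨ cong toℚ cardRel≡cardIn ⟨
    toℚ (cardRel A)                            ≡⟨ m/ℕn*n≡m (cardRel A) (m*n>0 0<∣E₁∣ 0<∣E₂∣) ⟨
    δA * toℚ (∣ E₁ ∣ ℕ.* ∣ E₂ ∣)                ≡⟨ cong (δA *_) (toℚ-* ∣ E₁ ∣ ∣ E₂ ∣) ⟩
    δA * (toℚ ∣ E₁ ∣ * toℚ ∣ E₂ ∣)              ≡⟨ *-assoc δA _ _ ⟨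
    δA * toℚ ∣ E₁ ∣ * toℚ ∣ E₂ ∣                ∎)
    where open ≡-Reasoning

  density≤1 : density E₁ E₂ A ≤ 1ℚ
  density≤1 = *-cancelʳ-≤-pos (toℚ ∣ E₁ ∣) {{positive (toℚ-pos 0<∣E₁∣)}} (begin
    δA * toℚ ∣ E₁ ∣               ≡⟨ sumOverγ≡density*∣E₁∣ ⟨
    sumOver E₁ γA                 ≤⟨ sumOver-mono-≤ E₁ (λ x _ → γ≤1 x) ⟩
    sumOver E₁ (λ _ → 1ℚ)        ≡⟨ sumOver-const E₁ 1ℚ ⟩
    1ℚ * toℚ ∣ E₁ ∣              ∎)
    where open ≤-Reasoning

  sumOver-deviation≡0 : sumOver E₁ (λ x → γA x - δA) ≡ 0ℚ
  sumOver-deviation≡0 = begin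
    sumOver E₁ (λ x → γA x - δA)               ≡⟨ sumOver-+ E₁ γA (λ _ → - δA) ⟩
    sumOver E₁ γA + sumOver E₁ (λ _ → - δA)    ≡⟨ cong₂ _+_ sumOverγ≡density*∣E₁∣ (sumOver-const E₁ (- δA)) ⟩
    δA * q₁ + (- δA) * q₁                      ≡⟨ *-distribʳ-+ q₁ δA (- δA) ⟨
    (δA - δA) * q₁                             ≡⟨ cong (_* q₁) (+-inverseʳ δA) ⟩
    0ℚ * q₁                                    ≡⟨ *-zeroˡ q₁ ⟩
    0ℚ                                         ∎
    where
    open ≡-Reasoning
    q₁ : ℚ
    q₁ = toℚ ∣ E₁ ∣

  deviation-bounds : ∀ x → - 1ℚ ≤ γA x - δA × γA x - δA ≤ 1ℚ
  deviation-bounds x =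
    subst (_≤ γA x - δA) (+-identityˡ (- 1ℚ)) (+-mono-≤ (/ℕ-nonNeg _ ∣ E₂ ∣) (neg-antimono-≤ density≤1)) ,
    subst (γA x - δA ≤_) (+-identityʳ 1ℚ) (+-mono-≤ (γ≤1 x) (neg-antimono-≤ (density-nonNeg E₁ E₂ A)))

  sumOverγ≡density+deviation : ∀ G → sumOver G γA ≡ δA * toℚ ∣ G ∣ + sumOver G (λ x → γA x - δA)
  sumOverγ≡density+deviation G = begin
    sumOver G γA
      ≡⟨ sumOver-cong G (λ x _ → solve 2 (λ a d → a := d :+ (a :- d)) refl (γA x) δA) ⟩
    sumOver G (λ x → δA + (γA x - δA))
      ≡⟨ sumOver-+ G (λ _ → δA) (λ x → γA x - δA) ⟩
    sumOver G (λ _ → δA) + sumOver G (λ x → γA x - δA)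
      ≡⟨ cong (_+ sumOver G (λ x → γA x - δA)) (sumOver-const G δA) ⟩
    δA * toℚ ∣ G ∣ + sumOver G (λ x → γA x - δA)
      ∎
    where
    open ≡-Reasoning
    open +-*-Solver

  rowVariance⇒denseRows : ∀ {ζ} → 0ℚ ≤ ζ → ζ ≤ 1ℚ →
    ζ * ζ * toℚ ∣ E₁ ∣ < sumOver E₁ (λ x → (γ_ E₂ A x - density E₁ E₂ A) * (γ_ E₂ A x - density E₁ E₂ A)) →
    ∃ λ G → G ⊆ E₁ × ζ * ζ * toℚ ∣ E₁ ∣ * (+ 1 / 2) < toℚ ∣ G ∣
              × (density E₁ E₂ A + ζ * ζ * ζ * (+ 1 / 8)) * toℚ ∣ G ∣ * toℚ ∣ E₂ ∣ < toℚ (cardIn A G E₂)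
  rowVariance⇒denseRows {ζ} 0≤ζ ζ≤1 ζ²∣E₁∣<variance = G , G⊆E₁ , ζ²∣E₁∣/2<∣G∣ , denser
    where
    open ≤-Reasoning
    g : Fin N → ℚ
    g x = γA x - δA
    g-bounds : ∀ x → x ∈ E₁ → - 1ℚ ≤ g x × g x ≤ 1ℚ
    g-bounds x _ = deviation-bounds x
    G : Subset N
    G = positiveIn E₁ g
    G⊆E₁ : G ⊆ E₁
    G⊆E₁ = p∩q⊆p E₁ _
    S : ℚ
    S = sumOver G g
    ζ²∣E₁∣/2<S : ζ * ζ * toℚ ∣ E₁ ∣ * (+ 1 / 2) < S
    ζ²∣E₁∣/2<S = p<q+q⇒p/2<q (<-≤-trans ζ²∣E₁∣<variance
                   (sumOver-square≤2sumOver-positive E₁ g g-bounds sumOver-deviation≡0))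
    ζ²∣E₁∣/2<∣G∣ : ζ * ζ * toℚ ∣ E₁ ∣ * (+ 1 / 2) < toℚ ∣ G ∣
    ζ²∣E₁∣/2<∣G∣ = <-≤-trans ζ²∣E₁∣/2<S (sumOver-positive≤∣positive∣ E₁ g g-bounds)
    ∣G∣≤∣E₁∣ : toℚ ∣ G ∣ ≤ toℚ ∣ E₁ ∣
    ∣G∣≤∣E₁∣ = toℚ-mono-≤ (p⊆q⇒∣p∣≤∣q∣ G⊆E₁)
    increment<S : ζ * ζ * ζ * (+ 1 / 8) * toℚ ∣ G ∣ < S
    increment<S = begin-strict
      ζ * ζ * ζ * (+ 1 / 8) * toℚ ∣ G ∣    ≡⟨ *-xy∙z≈xz∙y (ζ * ζ * ζ) (+ 1 / 8) (toℚ ∣ G ∣) ⟩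
      ζ * ζ * ζ * toℚ ∣ G ∣ * (+ 1 / 8)    ≤⟨ cube/8≤square/2 0≤ζ ζ≤1 (toℚ-nonNeg ∣ G ∣) ∣G∣≤∣E₁∣ ⟩
      ζ * ζ * toℚ ∣ E₁ ∣ * (+ 1 / 2)       <⟨ ζ²∣E₁∣/2<S ⟩
      S                                    ∎
    denser : (δA + ζ * ζ * ζ * (+ 1 / 8)) * toℚ ∣ G ∣ * toℚ ∣ E₂ ∣ < toℚ (cardIn A G E₂)
    denser = begin-strict
      (δA + ζ * ζ * ζ * (+ 1 / 8)) * toℚ ∣ G ∣ * toℚ ∣ E₂ ∣
        ≡⟨ cong (_* toℚ ∣ E₂ ∣) (*-distribʳ-+ (toℚ ∣ G ∣) δA _) ⟩
      (δA * toℚ ∣ G ∣ + ζ * ζ * ζ * (+ 1 / 8) * (toℚ ∣ G ∣)) * toℚ ∣ E₂ ∣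
        <⟨ *-monoˡ-<-pos (toℚ ∣ E₂ ∣) {{positive (toℚ-pos 0<∣E₂∣)}} (+-monoʳ-< (δA * toℚ ∣ G ∣) increment<S) ⟩
      (δA * toℚ ∣ G ∣ + S) * toℚ ∣ E₂ ∣
        ≡⟨ cong (_* toℚ ∣ E₂ ∣) (sumOverγ≡density+deviation G) ⟨
      sumOver G γA * toℚ ∣ E₂ ∣
        ≡⟨ cardIn≡sumOverγ*∣E₂∣ G ⟨
      toℚ (cardIn A G E₂)
        ∎

DensityIncrement : ∀ {N} → Subset N → Subset N → Rel N → ℚ → Set
DensityIncrement {N} E₁ E₂ A ζ = ∃₂ (λ (G₁ G₂ : Subset N) → G₁ ⊆ E₁ × G₂ ⊆ E₂
  × (density E₁ E₂ A + ζ * ζ * ζ * (+ 1 / 8)) * toℚ ∣ G₁ ∣ * toℚ ∣ G₂ ∣ < toℚ (cardIn A G₁ G₂)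
  × ζ * ζ * ζ * toℚ ∣ E₂ ∣ * (+ 1 / 8) < toℚ ∣ G₁ ∣
  × ζ * ζ * ζ * toℚ ∣ E₂ ∣ * (+ 1 / 8) < toℚ ∣ G₂ ∣)

module _ {N : ℕ} {E₁ E₂ : Subset N} {A : Rel N}
         (A⊆E₁×E₂ : ∀ x y → T (A x y) → x ∈ E₁ × y ∈ E₂)
         (ne₁ : Nonempty E₁) (ne₂ : Nonempty E₂) (∣E₂∣≤∣E₁∣ : ∣ E₂ ∣ ℕ.≤ ∣ E₁ ∣)
         {ζ : ℚ} (0≤ζ : 0ℚ ≤ ζ) (ζ≤1 : ζ ≤ 1ℚ) where

  private
    0<∣E₂∣ : 0ℚ < toℚ ∣ E₂ ∣
    0<∣E₂∣ = toℚ-pos (nonempty⇒∣∣>0 ne₂)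
    ζ³∣E₂∣/8<∣E₁∣ : ζ * ζ * ζ * toℚ ∣ E₂ ∣ * (+ 1 / 8) < toℚ ∣ E₁ ∣
    ζ³∣E₂∣/8<∣E₁∣ = cube/8< 0≤ζ ζ≤1 0<∣E₂∣ (toℚ-mono-≤ ∣E₂∣≤∣E₁∣)
    ζ³∣E₂∣/8<∣E₂∣ : ζ * ζ * ζ * toℚ ∣ E₂ ∣ * (+ 1 / 8) < toℚ ∣ E₂ ∣
    ζ³∣E₂∣/8<∣E₂∣ = cube/8< 0≤ζ ζ≤1 0<∣E₂∣ ≤-refl
    ζ³∣E₂∣/8≤ζ²∣E₂∣/2 : ζ * ζ * ζ * toℚ ∣ E₂ ∣ * (+ 1 / 8) ≤ ζ * ζ * toℚ ∣ E₂ ∣ * (+ 1 / 2)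
    ζ³∣E₂∣/8≤ζ²∣E₂∣/2 = cube/8≤square/2 0≤ζ ζ≤1 (<⇒≤ 0<∣E₂∣) ≤-refl
    ζ³∣E₂∣/8≤ζ²∣E₁∣/2 : ζ * ζ * ζ * toℚ ∣ E₂ ∣ * (+ 1 / 8) ≤ ζ * ζ * toℚ ∣ E₁ ∣ * (+ 1 / 2)
    ζ³∣E₂∣/8≤ζ²∣E₁∣/2 = cube/8≤square/2 0≤ζ ζ≤1 (<⇒≤ 0<∣E₂∣) (toℚ-mono-≤ ∣E₂∣≤∣E₁∣)

  rowVariance⇒densityIncrement :
    ζ * ζ * toℚ ∣ E₁ ∣ < sumOver E₁ (λ x → (γ_ E₂ A x - density E₁ E₂ A) * (γ_ E₂ A x - density E₁ E₂ A)) →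
    DensityIncrement E₁ E₂ A ζ
  rowVariance⇒densityIncrement ζ²∣E₁∣<variance =
    let G , G⊆E₁ , ζ²∣E₁∣/2<∣G∣ , denser = rowVariance⇒denseRows A⊆E₁×E₂ ne₁ ne₂ 0≤ζ ζ≤1 ζ²∣E₁∣<variance
    in  G , E₂ , G⊆E₁ , (λ y∈E₂ → y∈E₂) , denser , ≤-<-trans ζ³∣E₂∣/8≤ζ²∣E₁∣/2 ζ²∣E₁∣/2<∣G∣ , ζ³∣E₂∣/8<∣E₂∣

  columnVariance⇒densityIncrement :
    ζ * ζ * toℚ ∣ E₂ ∣ < sumOver E₂ (λ y → (δ_ E₁ A y - density E₁ E₂ A) * (δ_ E₁ A y - density E₁ E₂ A)) →
    DensityIncrement E₁ E₂ A ζ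
  columnVariance⇒densityIncrement ζ²∣E₂∣<variance =
    let G , G⊆E₂ , ζ²∣E₂∣/2<∣G∣ , denser = rowVariance⇒denseRows Aᵀ⊆E₂×E₁ ne₂ ne₁ 0≤ζ ζ≤1 ζ²∣E₂∣<varianceᵀ
    in  E₁ , G , (λ x∈E₁ → x∈E₁) , G⊆E₂ , subst₂ _<_ (reorder G) (cong toℚ (cardIn-ᵀ A E₁ G)) denser
      , ζ³∣E₂∣/8<∣E₁∣ , ≤-<-trans ζ³∣E₂∣/8≤ζ²∣E₂∣/2 ζ²∣E₂∣/2<∣G∣
    where
    Aᵀ⊆E₂×E₁ : ∀ y x → T ((A ᵀ) y x) → y ∈ E₂ × x ∈ E₁
    Aᵀ⊆E₂×E₁ y x t = proj₂ (A⊆E₁×E₂ x y t) , proj₁ (A⊆E₁×E₂ x y t)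
    ζ²∣E₂∣<varianceᵀ : ζ * ζ * toℚ ∣ E₂ ∣
      < sumOver E₂ (λ y → (γ_ E₁ (A ᵀ) y - density E₂ E₁ (A ᵀ)) * (γ_ E₁ (A ᵀ) y - density E₂ E₁ (A ᵀ)))
    ζ²∣E₂∣<varianceᵀ = subst (λ d → ζ * ζ * toℚ ∣ E₂ ∣ < sumOver E₂ (λ y → (δ_ E₁ A y - d) * (δ_ E₁ A y - d)))
                             (sym (density-ᵀ E₁ E₂ A)) ζ²∣E₂∣<variance
    reorder : ∀ G → (density E₂ E₁ (A ᵀ) + ζ * ζ * ζ * (+ 1 / 8)) * toℚ ∣ G ∣ * toℚ ∣ E₁ ∣
                    ≡ (density E₁ E₂ A + ζ * ζ * ζ * (+ 1 / 8)) * toℚ ∣ E₁ ∣ * toℚ ∣ G ∣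
    reorder G rewrite density-ᵀ E₁ E₂ A =
      *-xy∙z≈xz∙y (density E₁ E₂ A + ζ * ζ * ζ * (+ 1 / 8)) (toℚ ∣ G ∣) (toℚ ∣ E₁ ∣)

decide-both : ∀ {p q r} {P : Set p} {Q : Set q} {R : Set r} →
              Dec P → Dec Q → (¬ P → R) → (¬ Q → R) → (P × Q) ⊎ R
decide-both (yes p) (yes q) _   _   = inj₁ (p , q)
decide-both (no ¬p) _       ¬P⇒R _   = inj₂ (¬P⇒R ¬p)
decide-both (yes _) (no ¬q) _   ¬Q⇒R = inj₂ (¬Q⇒R ¬q)

lemma4p8 : (N : ℕ) (E₁ E₂ : Subset N) → Nonempty E₁ → Nonempty E₂ → ∣ E₂ ∣ ℕ.≤ ∣ E₁ ∣ →
    (A : Rel N) → (∀ x y → T (A x y) → x ∈ E₁ × y ∈ E₂) →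
    (ζ : ℚ) → 0ℚ < ζ → ζ < density E₁ E₂ A * density E₁ E₂ A →
    ((sumOver E₂ (λ y → (δ_ E₁ A y - density E₁ E₂ A) * (δ_ E₁ A y - density E₁ E₂ A)) ≤ ζ * ζ * toℚ ∣ E₂ ∣)
      × (sumOver E₁ (λ x → (γ_ E₂ A x - density E₁ E₂ A) * (γ_ E₂ A x - density E₁ E₂ A)) ≤ ζ * ζ * toℚ ∣ E₁ ∣))
    ⊎ ∃₂ (λ (G₁ G₂ : Subset N) → G₁ ⊆ E₁ × G₂ ⊆ E₂
      × (density E₁ E₂ A + ζ * ζ * ζ * (+ 1 / 8)) * toℚ ∣ G₁ ∣ * toℚ ∣ G₂ ∣ < toℚ (cardIn A G₁ G₂)
      × ζ * ζ * ζ * toℚ ∣ E₂ ∣ * (+ 1 / 8) < toℚ ∣ G₁ ∣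
      × ζ * ζ * ζ * toℚ ∣ E₂ ∣ * (+ 1 / 8) < toℚ ∣ G₂ ∣)
lemma4p8 N E₁ E₂ ne₁ ne₂ ∣E₂∣≤∣E₁∣ A A⊆E₁×E₂ ζ 0<ζ ζ<δ² =
  decide-both (_ ≤? _) (_ ≤? _)
    (columnVariance⇒densityIncrement A⊆E₁×E₂ ne₁ ne₂ ∣E₂∣≤∣E₁∣ 0≤ζ ζ≤1 ∘ ≰⇒>)
    (rowVariance⇒densityIncrement A⊆E₁×E₂ ne₁ ne₂ ∣E₂∣≤∣E₁∣ 0≤ζ ζ≤1 ∘ ≰⇒>)
  where
  0≤ζ : 0ℚ ≤ ζ
  0≤ζ = <⇒≤ 0<ζ
  ζ≤1 : ζ ≤ 1ℚ
  ζ≤1 = <⇒≤ (<-≤-trans ζ<δ² (x*x≤1 (density-nonNeg E₁ E₂ A) (density≤1 A⊆E₁×E₂ ne₁ ne₂)))
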